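{- Let $p(j)=\binom{j+5}{5}$. The largest positive integer $n$ that cannot be written as $n=\sum_{j\in S}\binom{j+5}{5}$ for some finite set $S$ of integers $j\ge 0$ is $120838$. In other words, $120838$ has no such representation, and every integer $n>120838$ has one.
   Context: A representation of $n$ as a sum of distinct values of $p(j)$ with $j\ge j_0$ means a finite set $S$ of integers, each $\ge j_0$, such that $n=\sum_{j\in S}p(j)$. Since each index is used at most once, the summands are distinct values. Here $j_0=0$. -}

module Defs where

open import Data.Nat using (ℕ; _+_)
open import Data.Nat.Combinatorics using (_C_)
open import Data.List using (List; map)
open import Data.Nat.ListAction using (sum)
open import Data.List.Relation.Unary.Unique.Propositional using (Unique)
open import Data.Product using (Σ; _×_)
open import Relation.Binary.PropositionalEquality using (_≡_)

p : ℕ → ℕ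
p j = (j + 5) C 5

-- A finite set S of integers j ≥ 0 (j₀ = 0), encoded as a duplicate-free list of naturals.
-- n is representable iff n = Σ_{j ∈ S} p(j).
Representable : ℕ → Set
Representable n = Σ (List ℕ) λ S → Unique S × sum (map p S) ≡ n

-- Let X k be the set of sums of distinct p j with j < k. Then X (k + 1) = X k ∪ (p k + X k),
-- so X k can be computed exactly as a finite union of intervals. Since p (j + 1) ≤ 2 p j for
-- j ≥ 4, Richert's argument applies: once X 24 contains every n with N < n ≤ N + p 24, the set
-- X j contains (N, N + p j] for every j ≥ 24, so every n > N is representable. Conversely a
-- representation of 120838 < p 25 only uses indices below 25, and 120838 ∉ X 25.
module Submission where

open import Defs
open import Data.Nat using (ℕ; _<_)
open import Data.Product using (_×_)
open import Relation.Nullary using (¬_)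

open import Data.Nat using (zero; suc; _+_; _∸_; _⊔_; _⊔′_; _≤_; _≤′_; ≤′-reflexive; ≤′-step; z≤n; s≤s; _≤?_; _≟_)
open import Data.Nat.Properties
open import Algebra.Properties.CommutativeSemigroup +-commutativeSemigroup using (x∙yz≈y∙xz)
open import Data.Nat.Combinatorics using (_C_; nC1≡n; nCk≡nC[n∸k]; nCk+nC[k+1]≡[n+1]C[k+1])
open import Data.Nat.ListAction using (sum)
open import Data.List using (List; []; _∷_; map; filter; merge)
open import Data.List.Properties using (filter-accept; filter-reject; filter-all)
open import Data.List.Relation.Unary.All as All using (All; []; _∷_)
open import Data.List.Relation.Unary.All.Properties using (all-filter; ¬Any⇒All¬)
  renaming (filter⁺ to All-filter⁺)
open import Data.List.Relation.Unary.Any as Any using (Any; here; there; any?)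
open import Data.List.Relation.Unary.Any.Properties using (map⁺; ++⁺ˡ; ++⁺ʳ; ++⁻)
open import Data.List.Relation.Unary.Unique.Propositional using (Unique)
open import Data.List.Relation.Unary.Unique.Propositional.Properties using ()
  renaming (filter⁺ to Unique-filter⁺)
open import Data.List.Relation.Unary.AllPairs using ([]; _∷_)
open import Data.List.Relation.Binary.Permutation.Propositional using (↭-sym)
open import Data.List.Relation.Binary.Permutation.Propositional.Properties
  using (Any-resp-↭; merge-↭)
open import Data.List.Membership.Propositional using (_∈_)
open import Data.List.Membership.DecPropositional _≟_ using (_∈?_)
open import Data.Product as Prod using (Σ; ∃; _,_; proj₁)
open import Data.Sum using (_⊎_; inj₁; inj₂; [_,_]′)
open import Data.Unit using (tt)
open import Function using (_∘_)
open import Relation.Nullary using (Dec; yes; no; ¬?; contradiction)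
open import Relation.Nullary.Decidable using (_×-dec_; from-yes; from-no)
open import Relation.Binary.PropositionalEquality
  using (_≡_; refl; sym; trans; cong; subst)

open ≤-Reasoning

C-pascal : ∀ n k → suc n C suc k ≡ n C k + n C suc k
C-pascal n k = sym (nCk+nC[k+1]≡[n+1]C[k+1] n k)

C-positive : ∀ {n k} → k ≤ n → 0 < n C k
C-positive {k = zero} _ = s≤s z≤n
C-positive {suc n} {suc k} (s≤s k≤n) = begin-strict
  0                    <⟨ C-positive k≤n ⟩
  n C k                ≤⟨ m≤m+n (n C k) (n C suc k) ⟩
  n C k + n C suc k    ≡⟨ C-pascal n k ⟨
  suc n C suc k        ∎

C-symmetric : ∀ a b → (a + b) C a ≡ (a + b) C b
C-symmetric a b = trans (nCk≡nC[n∸k] (m≤m+n a b)) (cong ((a + b) C_) (m+n∸m≡n a b))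

C-nondecreasing : ∀ {n k} → k + suc k ≤ n → n C k ≤ n C suc k
C-nondecreasing {n} {zero} 1≤n = subst (1 ≤_) (sym (nC1≡n n)) 1≤n
C-nondecreasing {suc n} {suc k} 2k+3≤1+n with m≤n⇒m<n∨m≡n 2k+3≤1+n
... | inj₁ (s≤s 2k+3≤n) = begin
  suc n C suc k                   ≡⟨ C-pascal n k ⟩
  n C k + n C suc k               ≤⟨ +-mono-≤ (C-nondecreasing 2k+1≤n) (C-nondecreasing 2k+3≤n) ⟩
  n C suc k + n C suc (suc k)     ≡⟨ C-pascal n (suc k) ⟨
  suc n C suc (suc k)             ∎
  where
  2k+1≤n : k + suc k ≤ n
  2k+1≤n = ≤-trans (+-mono-≤ (n≤1+n k) (n≤1+n (suc k))) 2k+3≤n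
... | inj₂ 2k+3≡1+n =
  subst (λ m → m C suc k ≤ m C suc (suc k)) 2k+3≡1+n
        (≤-reflexive (C-symmetric (suc k) (suc (suc k))))

p-suc : ∀ j → p (suc j) ≡ (j + 5) C 4 + p j
p-suc j = C-pascal (j + 5) 4

p-increasing : ∀ j → p j < p (suc j)
p-increasing j = subst (p j <_) (sym (p-suc j))
  (m<n+m (p j) (C-positive (≤-trans (n≤1+n 4) (m≤n+m 5 j))))

p-doubling : ∀ {j} → 4 ≤ j → p (suc j) ≤ p j + p j
p-doubling {j} 4≤j = begin
  p (suc j)            ≡⟨ p-suc j ⟩
  (j + 5) C 4 + p j    ≤⟨ +-monoˡ-≤ (p j) (C-nondecreasing (+-monoˡ-≤ 5 4≤j)) ⟩
  p j + p j            ∎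

module _ {f : ℕ → ℕ} (f-increasing : ∀ j → f j < f (suc j)) where

  increasing⇒monotone : ∀ {i j} → i ≤ j → f i ≤ f j
  increasing⇒monotone = go ∘ ≤⇒≤′
    where
    go : ∀ {i j} → i ≤′ j → f i ≤ f j
    go (≤′-reflexive refl) = ≤-refl
    go (≤′-step i≤′j) = ≤-trans (go i≤′j) (<⇒≤ (f-increasing _))

  increasing⇒inflationary : ∀ n → n ≤ f n
  increasing⇒inflationary zero = z≤n
  increasing⇒inflationary (suc n) = ≤-<-trans (increasing⇒inflationary n) (f-increasing n)

  ∈⇒≤sum : ∀ {j S} → j ∈ S → f j ≤ sum (map f S)
  ∈⇒≤sum {S = x ∷ S} (here refl) = m≤m+n (f x) _
  ∈⇒≤sum {S = x ∷ S} (there j∈S) = ≤-trans (∈⇒≤sum j∈S) (m≤n+m _ (f x))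

  indices-below : ∀ {k} S → sum (map f S) < f k → All (_< k) S
  indices-below S sum<fk = All.tabulate λ {j} j∈S →
    ≰⇒> λ k≤j → <-irrefl refl (<-≤-trans sum<fk
      (≤-trans (increasing⇒monotone k≤j) (∈⇒≤sum j∈S)))

SubsetSum : (ℕ → ℕ) → ℕ → ℕ → Set
SubsetSum f k n = Σ (List ℕ) λ S → Unique S × All (_< k) S × sum (map f S) ≡ n

module _ {f : ℕ → ℕ} where

  SubsetSum-zero : SubsetSum f 0 0
  SubsetSum-zero = [] , [] , [] , refl

  SubsetSum-zero⁻ : ∀ {n} → SubsetSum f 0 n → n ≡ 0
  SubsetSum-zero⁻ (_ , _ , [] , sum≡n) = sym sum≡n

  SubsetSum-skip : ∀ {k n} → SubsetSum f k n → SubsetSum f (suc k) n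
  SubsetSum-skip (S , u , S<k , sum≡n) = S , u , All.map m<n⇒m<1+n S<k , sum≡n

  SubsetSum-take : ∀ {k n} → SubsetSum f k n → SubsetSum f (suc k) (f k + n)
  SubsetSum-take {k} (S , u , S<k , sum≡n) =
    k ∷ S , All.map (λ j<k k≡j → <-irrefl (sym k≡j) j<k) S<k ∷ u
          , n<1+n k ∷ All.map m<n⇒m<1+n S<k , cong (f k +_) sum≡n

  private
    _without_ : List ℕ → ℕ → List ℕ
    S without k = filter (λ j → ¬? (j ≟ k)) S

    sum-without : ∀ {k S} → Unique S → k ∈ S →
                  sum (map f S) ≡ f k + sum (map f (S without k))
    sum-without {k} {j ∷ S} (j∉S ∷ _) (here refl)
      rewrite filter-reject (λ i → ¬? (i ≟ k)) {k} {S} (λ k≢k → k≢k refl)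
            | filter-all (λ i → ¬? (i ≟ k)) (All.map (λ k≢i i≡k → k≢i (sym i≡k)) j∉S)
      = refl
    sum-without {k} {j ∷ S} (j∉S ∷ u) (there k∈S)
      rewrite filter-accept (λ i → ¬? (i ≟ k)) {j} {S} (All.lookup j∉S k∈S)
            | sum-without u k∈S
      = x∙yz≈y∙xz (f j) (f k) _

  SubsetSum-suc⁻ : ∀ {k n} → SubsetSum f (suc k) n →
                   SubsetSum f k n ⊎ ∃ λ m → SubsetSum f k m × n ≡ f k + m
  SubsetSum-suc⁻ {k} (S , u , S<1+k , refl) with k ∈? S
  ... | yes k∈S = inj₂ (_ , (S without k , Unique-filter⁺ _ u , S′<k , refl) , sum-without u k∈S)
    where
    S′<k : All (_< k) (S without k)
    S′<k = All.zipWith (λ (j<1+k , j≢k) → ≤∧≢⇒< (≤-pred j<1+k) j≢k)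
                       (All-filter⁺ _ S<1+k , all-filter _ S)
  ... | no k∉S = inj₁ (S , u , All.zipWith (λ (j<1+k , k≢j) → ≤∧≢⇒< (≤-pred j<1+k) (k≢j ∘ sym))
                                           (S<1+k , ¬Any⇒All¬ S k∉S) , refl)

module Richert {f : ℕ → ℕ} {k N : ℕ}
       (doubling : ∀ {j} → k ≤ j → f (suc j) ≤ f j + f j)
       (base : ∀ {n} → N < n → n ≤ N + f k → SubsetSum f k n) where

  subsetSum : ∀ {j n} → k ≤ j → N < n → n ≤ N + f j → SubsetSum f j n
  subsetSum = go ∘ ≤⇒≤′
    where
    go : ∀ {j n} → k ≤′ j → N < n → n ≤ N + f j → SubsetSum f j n
    go (≤′-reflexive refl) = base
    go {suc j} {n} (≤′-step k≤′j) N<n n≤N+f[1+j] with n ≤? N + f j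
    ... | yes n≤N+fj = SubsetSum-skip (go k≤′j N<n n≤N+fj)
    ... | no n≰N+fj = subst (SubsetSum f (suc j)) (m+[n∸m]≡n fj≤n)
                            (SubsetSum-take (go k≤′j N<n∸fj n∸fj≤N+fj))
      where
      N+fj<n : N + f j < n
      N+fj<n = ≰⇒> n≰N+fj
      fj≤n : f j ≤ n
      fj≤n = ≤-trans (m≤n+m (f j) N) (<⇒≤ N+fj<n)
      N<n∸fj : N < n ∸ f j
      N<n∸fj = m+n≤o⇒m≤o∸n (suc N) N+fj<n
      n∸fj≤N+fj : n ∸ f j ≤ N + f j
      n∸fj≤N+fj = m≤n+o⇒m∸n≤o n (f j) (begin
        n                    ≤⟨ n≤N+f[1+j] ⟩
        N + f (suc j)        ≤⟨ +-monoʳ-≤ N (doubling (≤′⇒≤ k≤′j)) ⟩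
        N + (f j + f j)      ≡⟨ x∙yz≈y∙xz N (f j) (f j) ⟩
        f j + (N + f j)      ∎)

Interval : Set
Interval = ℕ × ℕ

infix 4 _∈ᵢ_ _∈ᵢ?_ _⊆ᵢ_ _⊆ᵢ?_ _∈⋃_

_∈ᵢ_ : ℕ → Interval → Set
n ∈ᵢ (a , b) = a ≤ n × n ≤ b

_∈ᵢ?_ : ∀ n i → Dec (n ∈ᵢ i)
n ∈ᵢ? (a , b) = a ≤? n ×-dec n ≤? b

_⊆ᵢ_ : Interval → Interval → Set
(lo , hi) ⊆ᵢ (a , b) = a ≤ lo × hi ≤ b

_⊆ᵢ?_ : ∀ i i′ → Dec (i ⊆ᵢ i′)
(lo , hi) ⊆ᵢ? (a , b) = a ≤? lo ×-dec hi ≤? b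

_∈⋃_ : ℕ → List Interval → Set
n ∈⋃ is = Any (n ∈ᵢ_) is

⊆ᵢ⇒∈⋃ : ∀ {i is n} → Any (i ⊆ᵢ_) is → n ∈ᵢ i → n ∈⋃ is
⊆ᵢ⇒∈⋃ {lo , hi} {n = n} i⊆is (lo≤n , n≤hi) =
  Any.map (λ (a≤lo , hi≤b) → ≤-trans a≤lo lo≤n , ≤-trans n≤hi hi≤b) i⊆is

shift : ℕ → List Interval → List Interval
shift c = map (Prod.map (c +_) (c +_))

∈⋃-shift⁺ : ∀ {c m is} → m ∈⋃ is → c + m ∈⋃ shift c is
∈⋃-shift⁺ {c} m∈is = map⁺ (Any.map (Prod.map (+-monoʳ-≤ c) (+-monoʳ-≤ c)) m∈is)

∈⋃-shift⁻ : ∀ {c n} is → n ∈⋃ shift c is → ∃ λ m → m ∈⋃ is × n ≡ c + m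
∈⋃-shift⁻ {c} {n} ((a , b) ∷ is) (here (c+a≤n , n≤c+b)) =
  n ∸ c , here (m+n≤o⇒m≤o∸n a (subst (_≤ n) (+-comm c a) c+a≤n) , m≤n+o⇒m∸n≤o n c n≤c+b)
        , sym (m+[n∸m]≡n (≤-trans (m≤m+n c a) c+a≤n))
∈⋃-shift⁻ (_ ∷ is) (there n∈is) with ∈⋃-shift⁻ is n∈is
... | m , m∈is , n≡c+m = m , there m∈is , n≡c+m

mergeByLeft : List Interval → List Interval → List Interval
mergeByLeft = merge {R = λ i i′ → proj₁ i ≤ proj₁ i′} (λ i i′ → proj₁ i ≤? proj₁ i′)

∈⋃-merge⁺ : ∀ {n is js} → n ∈⋃ is ⊎ n ∈⋃ js → n ∈⋃ mergeByLeft is js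
∈⋃-merge⁺ {is = is} {js} n∈is⊎js =
  Any-resp-↭ (↭-sym (merge-↭ _ is js)) ([ ++⁺ˡ , ++⁺ʳ is ]′ n∈is⊎js)

∈⋃-merge⁻ : ∀ {n is js} → n ∈⋃ mergeByLeft is js → n ∈⋃ is ⊎ n ∈⋃ js
∈⋃-merge⁻ {is = is} {js} n∈merge = ++⁻ is (Any-resp-↭ (merge-↭ _ is js) n∈merge)

-- The fusion test only asks a ≤ c ≤ b + 1, which makes the union exact without any
-- sortedness invariant; sorting by left end points only makes fusion frequent.
absorb : Interval → List Interval → List Interval
absorb i [] = i ∷ []
absorb (a , b) ((c , d) ∷ is) with a ≤? c ×-dec c ≤? suc b
... | yes _ = absorb (a , b ⊔′ d) is
... | no _ = (a , b) ∷ absorb (c , d) is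

compress : List Interval → List Interval
compress [] = []
compress (i ∷ is) = absorb i is

module _ {a b c d : ℕ} (a≤c : a ≤ c) (c≤1+b : c ≤ suc b) where

  ∈ᵢ-fuse⁺ : ∀ {n} → n ∈ᵢ (a , b) ⊎ n ∈ᵢ (c , d) → n ∈ᵢ (a , b ⊔′ d)
  ∈ᵢ-fuse⁺ (inj₁ (a≤n , n≤b)) = a≤n , subst (_ ≤_) (⊔≡⊔′ b d) (m≤n⇒m≤n⊔o d n≤b)
  ∈ᵢ-fuse⁺ (inj₂ (c≤n , n≤d)) = ≤-trans a≤c c≤n , subst (_ ≤_) (⊔≡⊔′ b d) (m≤n⇒m≤o⊔n b n≤d)

  ∈ᵢ-fuse⁻ : ∀ {n} → n ∈ᵢ (a , b ⊔′ d) → n ∈ᵢ (a , b) ⊎ n ∈ᵢ (c , d)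
  ∈ᵢ-fuse⁻ {n} (a≤n , n≤b⊔′d) = split (subst (n ≤_) (sym (⊔≡⊔′ b d)) n≤b⊔′d)
    where
    split : n ≤ b ⊔ d → n ∈ᵢ (a , b) ⊎ n ∈ᵢ (c , d)
    split n≤b⊔d with n ≤? b | ⊔-sel b d
    ... | yes n≤b | _ = inj₁ (a≤n , n≤b)
    ... | no n≰b | inj₁ b⊔d≡b = contradiction (subst (n ≤_) b⊔d≡b n≤b⊔d) n≰b
    ... | no n≰b | inj₂ b⊔d≡d = inj₂ (≤-trans c≤1+b (≰⇒> n≰b) , subst (n ≤_) b⊔d≡d n≤b⊔d)

∈⋃-absorb⁺ : ∀ {n i} is → n ∈⋃ (i ∷ is) → n ∈⋃ absorb i is
∈⋃-absorb⁺ [] n∈i = n∈i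
∈⋃-absorb⁺ {n} {a , b} ((c , d) ∷ is) n∈ with a ≤? c ×-dec c ≤? suc b
... | yes (a≤c , c≤1+b) = ∈⋃-absorb⁺ is (fuse n∈)
  where
  fuse : n ∈⋃ ((a , b) ∷ (c , d) ∷ is) → n ∈⋃ ((a , b ⊔′ d) ∷ is)
  fuse (here n∈ab) = here (∈ᵢ-fuse⁺ {d = d} a≤c c≤1+b (inj₁ n∈ab))
  fuse (there (here n∈cd)) = here (∈ᵢ-fuse⁺ a≤c c≤1+b (inj₂ n∈cd))
  fuse (there (there n∈is)) = there n∈is
... | no _ with n∈
...   | here n∈ab = here n∈ab
...   | there n∈rest = there (∈⋃-absorb⁺ is n∈rest)

∈⋃-absorb⁻ : ∀ {n i} is → n ∈⋃ absorb i is → n ∈⋃ (i ∷ is)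
∈⋃-absorb⁻ [] n∈i = n∈i
∈⋃-absorb⁻ {i = a , b} ((c , d) ∷ is) n∈ with a ≤? c ×-dec c ≤? suc b
... | yes (a≤c , c≤1+b) with ∈⋃-absorb⁻ is n∈
...   | here n∈ab⊔d = [ here , there ∘ here ]′ (∈ᵢ-fuse⁻ a≤c c≤1+b n∈ab⊔d)
...   | there n∈is = there (there n∈is)
∈⋃-absorb⁻ ((c , d) ∷ is) n∈ | no _ with n∈
...   | here n∈ab = here n∈ab
...   | there n∈rest = there (∈⋃-absorb⁻ is n∈rest)

∈⋃-compress⁺ : ∀ {n} is → n ∈⋃ is → n ∈⋃ compress is
∈⋃-compress⁺ (i ∷ is) = ∈⋃-absorb⁺ is

∈⋃-compress⁻ : ∀ {n} is → n ∈⋃ compress is → n ∈⋃ is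
∈⋃-compress⁻ (i ∷ is) = ∈⋃-absorb⁻ is

addSummand : ℕ → List Interval → List Interval
addSummand c is = compress (mergeByLeft is (shift c is))

subsetSumIntervals : (ℕ → ℕ) → ℕ → List Interval
subsetSumIntervals f zero = (0 , 0) ∷ []
subsetSumIntervals f (suc k) = addSummand (f k) (subsetSumIntervals f k)

module _ {f : ℕ → ℕ} where

  subsetSumIntervals-sound : ∀ {k n} → n ∈⋃ subsetSumIntervals f k → SubsetSum f k n
  subsetSumIntervals-sound {zero} (here (z≤n , n≤0)) =
    subst (SubsetSum f 0) (sym (n≤0⇒n≡0 n≤0)) SubsetSum-zero
  subsetSumIntervals-sound {suc k} n∈ with ∈⋃-merge⁻ (∈⋃-compress⁻ _ n∈)
  ... | inj₁ n∈is = SubsetSum-skip (subsetSumIntervals-sound n∈is)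
  ... | inj₂ n∈shift with ∈⋃-shift⁻ _ n∈shift
  ...   | m , m∈is , refl = SubsetSum-take (subsetSumIntervals-sound m∈is)

  subsetSumIntervals-complete : ∀ {k n} → SubsetSum f k n → n ∈⋃ subsetSumIntervals f k
  subsetSumIntervals-complete {zero} s rewrite SubsetSum-zero⁻ s = here (z≤n , z≤n)
  subsetSumIntervals-complete {suc k} s = ∈⋃-compress⁺ _ (∈⋃-merge⁺ (case s))
    where
    is = subsetSumIntervals f k
    case : SubsetSum f (suc k) _ → _ ∈⋃ is ⊎ _ ∈⋃ shift (f k) is
    case s with SubsetSum-suc⁻ s
    ... | inj₁ s′ = inj₁ (subsetSumIntervals-complete s′)
    ... | inj₂ (m , s′ , refl) = inj₂ (∈⋃-shift⁺ (subsetSumIntervals-complete s′))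

mainTheorem3 : ¬ Representable 120838 × ((n : ℕ) → 120838 < n → Representable n)
mainTheorem3 = not-representable , representable
  where
  N = 120838

  N∉intervals : ¬ N ∈⋃ subsetSumIntervals p 25
  N∉intervals = from-no (any? (N ∈ᵢ?_) (subsetSumIntervals p 25))

  covered : Any ((suc N , N + p 24) ⊆ᵢ_) (subsetSumIntervals p 24)
  covered = from-yes (any? ((suc N , N + p 24) ⊆ᵢ?_) (subsetSumIntervals p 24))

  N<p25 : N < p 25
  N<p25 = ≤ᵇ⇒≤ (suc N) (p 25) tt

  -- The implicit arguments are given so that unification never unfolds the interval lists.
  not-representable : ¬ Representable N
  not-representable (S , u , sum≡N) = N∉intervals (subsetSumIntervals-complete {f = p} {k = 25}
    (S , u , indices-below p-increasing S (subst (_< p 25) (sym sum≡N) N<p25) , sum≡N))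

  base : ∀ {n} → N < n → n ≤ N + p 24 → SubsetSum p 24 n
  base N<n n≤N+p24 = subsetSumIntervals-sound {f = p} {k = 24} (⊆ᵢ⇒∈⋃ covered (N<n , n≤N+p24))

  n≤N+p[n+24] : ∀ n → n ≤ N + p (n + 24)
  n≤N+p[n+24] n = begin
    n              ≤⟨ increasing⇒inflationary p-increasing n ⟩
    p n            ≤⟨ increasing⇒monotone p-increasing (m≤m+n n 24) ⟩
    p (n + 24)     ≤⟨ m≤n+m (p (n + 24)) N ⟩
    N + p (n + 24) ∎

  forget-bound : ∀ {k n} → SubsetSum p k n → Representable n
  forget-bound (S , u , _ , sum≡n) = S , u , sum≡n

  representable : ∀ n → N < n → Representable n
  representable n N<n = forget-bound
    (Richert.subsetSum {f = p} {k = 24} {N = N} (p-doubling ∘ ≤-trans (≤ᵇ⇒≤ 4 24 tt)) base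
                       (m≤n+m 24 n) N<n (n≤N+p[n+24] n))
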